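{- Let $N>2$ and let $0\le i\le j$ be integers. Then, for the $N$-player normal-play outcome of the two-heap \textsc{Nim} position $*i+*j$, $$o(*i+*j)=\begin{cases}\overline{\{\mathbf N\}} & \text{if } i=j=0,\\ \overline{\{\mathbf O_1,\dots,\mathbf O_{\min\{j,N-1\}}\}} & \text{if } i=0<j,\\ \overline{\{\mathbf O_2,\dots,\mathbf O_{\min\{i+j,N-1\}}\}} & \text{if } 1\le i\le N-2,\\ \{\mathbf O_1\} & \text{if } i=j=N-1,\\ \emptyset & \text{otherwise,}\end{cases}$$ where $\overline{S}$ denotes the complement of $S$ in $\{\mathbf N,\mathbf O_1,\dots,\mathbf O_{N-2},\mathbf P\}$.
   Context: All games are short impartial games: a game is identified with the finite set of its options, with no infinite runs. $G+H$ is the disjunctive sum, $0=\{\}$, $*n=\{*0,\dots,*(n-1)\}$ is a nim-heap. There are $N$ players moving cyclically; under normal play the player unable to move on their turn is the unique loser and all others win. The players, relative to a position, are denoted $\mathbf N=\mathbf O_0$ (next to move), $\mathbf O_1,\dots,\mathbf O_{N-2}$, and $\mathbf P=\mathbf O_{N-1}$ (previous), where $\mathbf O_i$ moves $i$ turns after $\mathbf N$. The outcome $o(G)\subseteq\{\mathbf O_0,\dots,\mathbf O_{N-1}\}$ is defined recursively: $\mathbf N\in o(G)$ iff some option $G'$ has $\mathbf P\in o(G')$; for $1\le i\le N-1$, $\mathbf O_i\in o(G)$ iff every option $G'$ has $\mathbf O_{i-1}\in o(G')$. -}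

module Defs where

open import Data.Nat using (ℕ; zero; suc; _+_; _∸_; _≤_; _≡ᵇ_; _≤ᵇ_; _⊔_; _⊓_)
open import Data.Bool using (Bool; true; false; if_then_else_; _∧_)
open import Data.List using (List; []; _∷_; _++_; _∷ʳ_)
open import Data.Fin using (Fin; fromℕ; inject₁)
open import Data.Product using (_×_)
open import Data.Sum using (_⊎_)
open import Data.Empty using (⊥)
open import Data.Unit using (⊤)
open import Relation.Nullary using (¬_)
open import Relation.Binary.PropositionalEquality using (_≡_)

data Game : Set where
  node : List Game → Game

options : Game → List Game
options (node gs) = gs

mutual
  _⊕_ : Game → Game → Game
  g@(node gs) ⊕ h@(node hs) = node (lefts gs h ++ rights g hs)

  lefts : List Game → Game → List Game
  lefts [] h = []
  lefts (g ∷ gs) h = (g ⊕ h) ∷ lefts gs h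

  rights : Game → List Game → List Game
  rights g [] = []
  rights g (h ∷ hs) = (g ⊕ h) ∷ rights g hs

infixl 6 _⊕_

nims : ℕ → List Game
nims zero = []
nims (suc n) = nims n ∷ʳ node (nims n)

nim : ℕ → Game
nim n = node (nims n)

-- N-player normal-play outcome, as a membership predicate.
-- Players are Fin N: index i stands for O_i (O_0 = N, O_(N-1) = P).
-- InOutcome N p G  means  p ∈ o(G).
mutual
  InOutcome : (N : ℕ) → Fin N → Game → Set
  InOutcome (suc m) Fin.zero (node gs) = SomeP m gs
  InOutcome (suc m) (Fin.suc i) (node gs) = EveryO m i gs

  SomeP : (m : ℕ) → List Game → Set
  SomeP m [] = ⊥
  SomeP m (g ∷ gs) = InOutcome (suc m) (fromℕ m) g ⊎ SomeP m gs

  EveryO : (m : ℕ) → Fin m → List Game → Set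
  EveryO m i [] = ⊤
  EveryO m i (g ∷ gs) = InOutcome (suc m) (inject₁ i) g × EveryO m i gs

claimedOutcome : (N i j k : ℕ) → Set
claimedOutcome N i j k =
  if (i ≡ᵇ 0) ∧ (j ≡ᵇ 0) then ¬ (k ≡ 0)
  else if i ≡ᵇ 0 then ¬ ((1 ≤ k) × (k ≤ j ⊓ (N ∸ 1)))
  else if i ≤ᵇ N ∸ 2 then ¬ ((2 ≤ k) × (k ≤ (i + j) ⊓ (N ∸ 1)))
  else if (i ≡ᵇ N ∸ 1) ∧ (j ≡ᵇ N ∸ 1) then k ≡ 1
  else ⊥

module Submission where

-- The proof exhibits an explicit formula  Expected i j k  (symmetric in the
-- heaps i and j) for "O_k ∈ o(*i + *j)" and shows that it satisfies the
-- recursion defining outcomes: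
--   * O_0 = N wins iff some option has P = O_m among its winners, and P wins
--     *a + *b iff a + b < m;
--   * O_(k+1) wins iff O_k wins every option.

open import Defs
open import Data.Nat using (ℕ; zero; suc; _+_; _<_; _≤_; _⊓_; _≡ᵇ_; z≤n; s≤s; z<s)
open import Data.Nat.Properties
open import Data.Nat.Induction using (<-rec)
open import Data.Fin using (Fin; toℕ; fromℕ; inject₁)
open import Data.Fin.Properties using (toℕ-fromℕ; toℕ-inject₁; toℕ≤pred[n])
open import Data.Bool using (if_then_else_)
open import Data.List using ([]; _∷_; _++_; map)
open import Data.List.Relation.Unary.Any using (Any; here; there)
open import Data.List.Relation.Unary.All using (All; []; _∷_)
import Data.List.Relation.Unary.Any.Properties as Any
import Data.List.Relation.Unary.All.Properties as All
open import Data.Product using (_×_; _,_; ∃-syntax)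
open import Data.Product.Function.NonDependent.Propositional using (_×-⇔_)
open import Data.Sum using (_⊎_; inj₁; inj₂; swap)
open import Data.Sum.Function.Propositional using (_⊎-⇔_)
open import Data.Empty using (⊥-elim)
open import Level using (0ℓ)
open import Relation.Nullary using (¬_; yes; no)
open import Relation.Nullary.Reflects using (Reflects; ofʸ; ofⁿ; fromEquivalence; _×-reflects_)
open import Relation.Binary.PropositionalEquality using (_≡_; refl; cong; cong₂)
open import Function.Bundles using (_⇔_; mk⇔; Equivalence)
open import Function.Properties.Equivalence using (⇔-setoid) renaming (trans to ⇔-trans)
open import Function.Properties.Inverse using (↔⇒⇔)
open import Relation.Binary.Reasoning.Setoid (⇔-setoid 0ℓ)

open Equivalence using (to; from)

lefts≡map : ∀ gs h → lefts gs h ≡ map (_⊕ h) gs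
lefts≡map []       h = refl
lefts≡map (g ∷ gs) h = cong (g ⊕ h ∷_) (lefts≡map gs h)

rights≡map : ∀ g hs → rights g hs ≡ map (g ⊕_) hs
rights≡map g []       = refl
rights≡map g (h ∷ hs) = cong (g ⊕ h ∷_) (rights≡map g hs)

options-nim-sum : ∀ i j →
  options (nim i ⊕ nim j) ≡ map (_⊕ nim j) (nims i) ++ map (nim i ⊕_) (nims j)
options-nim-sum i j = cong₂ _++_ (lefts≡map (nims i) (nim j)) (rights≡map (nim i) (nims j))

SomeP⇔Any : ∀ m gs → SomeP m gs ⇔ Any (InOutcome (suc m) (fromℕ m)) gs
SomeP⇔Any m gs = mk⇔ (someP→any gs) any→someP
  where
  someP→any : ∀ gs → SomeP m gs → Any (InOutcome (suc m) (fromℕ m)) gs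
  someP→any (g ∷ gs) (inj₁ p) = here p
  someP→any (g ∷ gs) (inj₂ s) = there (someP→any gs s)

  any→someP : ∀ {gs} → Any (InOutcome (suc m) (fromℕ m)) gs → SomeP m gs
  any→someP (here p)  = inj₁ p
  any→someP (there s) = inj₂ (any→someP s)

EveryO⇔All : ∀ m q gs → EveryO m q gs ⇔ All (InOutcome (suc m) (inject₁ q)) gs
EveryO⇔All m q gs = mk⇔ (everyO→all gs) all→everyO
  where
  everyO→all : ∀ gs → EveryO m q gs → All (InOutcome (suc m) (inject₁ q)) gs
  everyO→all []       _       = []
  everyO→all (g ∷ gs) (p , e) = p ∷ everyO→all gs e

  all→everyO : ∀ {gs} → All (InOutcome (suc m) (inject₁ q)) gs → EveryO m q gs
  all→everyO []       = _
  all→everyO (p ∷ ps) = p , all→everyO ps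

Any-nims : ∀ {P : Game → Set} n → Any P (nims n) ⇔ (∃[ a ] a < n × P (nim a))
Any-nims {P} n = mk⇔ (any→ n) (→any n)
  where
  any→ : ∀ n → Any P (nims n) → ∃[ a ] a < n × P (nim a)
  any→ (suc n) x with Any.++⁻ (nims n) x
  ... | inj₁ y with any→ n y
  ...   | a , a<n , p = a , m<n⇒m<1+n a<n , p
  any→ (suc n) x | inj₂ (here p) = n , n<1+n n , p

  →any : ∀ n → (∃[ a ] a < n × P (nim a)) → Any P (nims n)
  →any (suc n) (a , a<1+n , p) with m<1+n⇒m<n∨m≡n a<1+n
  ... | inj₁ a<n  = Any.++⁺ˡ (→any n (a , a<n , p))
  ... | inj₂ refl = Any.++⁺ʳ (nims n) (here p)

All-nims : ∀ {P : Game → Set} n → All P (nims n) ⇔ (∀ a → a < n → P (nim a))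
All-nims {P} n = mk⇔ (all→ n) (→all n)
  where
  all→ : ∀ n → All P (nims n) → ∀ a → a < n → P (nim a)
  all→ (suc n) ps a a<1+n with All.++⁻ (nims n) ps | m<1+n⇒m<n∨m≡n a<1+n
  ... | qs , _       | inj₁ a<n  = all→ n qs a a<n
  ... | _  , (p ∷ _) | inj₂ refl = p

  →all : ∀ n → (∀ a → a < n → P (nim a)) → All P (nims n)
  →all zero    _ = []
  →all (suc n) h = All.++⁺ (→all n (λ a a<n → h a (m<n⇒m<1+n a<n))) (h n (n<1+n n) ∷ [])

SomeMove : (ℕ → ℕ → Set) → ℕ → ℕ → Set
SomeMove R i j = (∃[ a ] a < i × R a j) ⊎ (∃[ b ] b < j × R i b)

EveryMove : (ℕ → ℕ → Set) → ℕ → ℕ → Set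
EveryMove R i j = (∀ a → a < i → R a j) × (∀ b → b < j → R i b)

Any-options : ∀ {P : Game → Set} i j →
  Any P (options (nim i ⊕ nim j)) ⇔ SomeMove (λ a b → P (nim a ⊕ nim b)) i j
Any-options {P} i j = begin
  Any P (options (nim i ⊕ nim j))
    ≡⟨ cong (Any P) (options-nim-sum i j) ⟩
  Any P (map (_⊕ nim j) (nims i) ++ map (nim i ⊕_) (nims j))
    ≈⟨ ↔⇒⇔ Any.++↔ ⟨
  (Any P (map (_⊕ nim j) (nims i)) ⊎ Any P (map (nim i ⊕_) (nims j)))
    ≈⟨ ↔⇒⇔ Any.map↔ ⊎-⇔ ↔⇒⇔ Any.map↔ ⟨
  (Any (λ g → P (g ⊕ nim j)) (nims i) ⊎ Any (λ g → P (nim i ⊕ g)) (nims j))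
    ≈⟨ Any-nims i ⊎-⇔ Any-nims j ⟩
  SomeMove (λ a b → P (nim a ⊕ nim b)) i j ∎

All-options : ∀ {P : Game → Set} i j →
  All P (options (nim i ⊕ nim j)) ⇔ EveryMove (λ a b → P (nim a ⊕ nim b)) i j
All-options {P} i j = begin
  All P (options (nim i ⊕ nim j))
    ≡⟨ cong (All P) (options-nim-sum i j) ⟩
  All P (map (_⊕ nim j) (nims i) ++ map (nim i ⊕_) (nims j))
    ≈⟨ mk⇔ (All.++⁻ _) (λ (ps , qs) → All.++⁺ ps qs) ⟩
  (All P (map (_⊕ nim j) (nims i)) × All P (map (nim i ⊕_) (nims j)))
    ≈⟨ mk⇔ All.map⁻ All.map⁺ ×-⇔ mk⇔ All.map⁻ All.map⁺ ⟩
  (All (λ g → P (g ⊕ nim j)) (nims i) × All (λ g → P (nim i ⊕ g)) (nims j))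
    ≈⟨ All-nims i ×-⇔ All-nims j ⟩
  EveryMove (λ a b → P (nim a ⊕ nim b)) i j ∎

EveryMove-map : ∀ {R S : ℕ → ℕ → Set} {i j} →
  (∀ {a b} → R a b → S a b) → EveryMove R i j → EveryMove S i j
EveryMove-map f (hL , hR) = (λ a a<i → f (hL a a<i)) , (λ b b<j → f (hR b b<j))

SomeMove-cong : ∀ {R S : ℕ → ℕ → Set} {i j} →
  EveryMove (λ a b → R a b ⇔ S a b) i j → SomeMove R i j ⇔ SomeMove S i j
SomeMove-cong (eL , eR) = mk⇔
  (λ { (inj₁ (a , a<i , r)) → inj₁ (a , a<i , to (eL a a<i) r)
     ; (inj₂ (b , b<j , r)) → inj₂ (b , b<j , to (eR b b<j) r) })
  (λ { (inj₁ (a , a<i , s)) → inj₁ (a , a<i , from (eL a a<i) s)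
     ; (inj₂ (b , b<j , s)) → inj₂ (b , b<j , from (eR b b<j) s) })

EveryMove-cong : ∀ {R S : ℕ → ℕ → Set} {i j} →
  EveryMove (λ a b → R a b ⇔ S a b) i j → EveryMove R i j ⇔ EveryMove S i j
EveryMove-cong (eL , eR) = mk⇔
  (λ (hL , hR) → (λ a a<i → to (eL a a<i) (hL a a<i)) , (λ b b<j → to (eR b b<j) (hR b b<j)))
  (λ (hL , hR) → (λ a a<i → from (eL a a<i) (hL a a<i)) , (λ b b<j → from (eR b b<j) (hR b b<j)))

sum-after-every-move : ∀ k i j → EveryMove (λ a b → a + b < k) i j ⇔ i + j < suc k
sum-after-every-move k i j = mk⇔ (bound i j) shrink
  where
  bound : ∀ i j → EveryMove (λ a b → a + b < k) i j → i + j < suc k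
  bound zero    zero    _        = z<s
  bound (suc i) j       (hL , _) = s≤s (hL i (n<1+n i))
  bound zero    (suc j) (_ , hR) = s≤s (hR j (n<1+n j))

  shrink : i + j < suc k → EveryMove (λ a b → a + b < k) i j
  shrink (s≤s i+j≤k) = (λ a a<i → <-≤-trans (+-monoˡ-< j a<i) i+j≤k)
                     , (λ b b<j → <-≤-trans (+-monoʳ-< i b<j) i+j≤k)

below-counterexample : ∀ {n i} {P : ℕ → Set} → ¬ P n → (∀ a → a < i → P a) → i ≤ n
below-counterexample {n} {i} ¬Pn h with n <? i
... | yes n<i = ⊥-elim (¬Pn (h n n<i))
... | no  n≮i = ≮⇒≥ n≮i

<⇔¬≤⊓ : ∀ {A : Set} {s k m} → A → k ≤ m → s < k ⇔ (¬ (A × k ≤ s ⊓ m))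
<⇔¬≤⊓ {s = s} {k} {m} a k≤m = mk⇔
  (λ s<k (_ , k≤s⊓m) → <⇒≱ s<k (m≤n⊓o⇒m≤n s m k≤s⊓m))
  complement
  where
  complement : ¬ (_ × k ≤ s ⊓ m) → s < k
  complement ¬both with k ≤? s
  ... | yes k≤s = ⊥-elim (¬both (a , ⊓-glb k≤s k≤m))
  ... | no  k≰s = ≰⇒> k≰s

⇔-if : ∀ {X A B P : Set} {b} → Reflects P b →
  (P → X ⇔ A) → (¬ P → X ⇔ B) → X ⇔ (if b then A else B)
⇔-if (ofʸ p)  onTrue onFalse = onTrue p
⇔-if (ofⁿ ¬p) onTrue onFalse = onFalse ¬p

≡ᵇ-reflects-≡ : ∀ a b → Reflects (a ≡ b) (a ≡ᵇ b)
≡ᵇ-reflects-≡ a b = fromEquivalence (≡ᵇ⇒≡ a b) (≡⇒≡ᵇ a b)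

module Formula (m' : ℕ) where

  m : ℕ
  m = suc (suc m')

  0<m : 0 < m
  0<m = z<s

  Expected : ℕ → ℕ → ℕ → Set
  Expected i j 0 = (0 < i × j < m) ⊎ (0 < j × i < m)
  Expected i j 1 = (i ≡ 0 × j ≡ 0) ⊎ (0 < i × 0 < j × (i < m ⊎ j < m ⊎ (i ≡ m × j ≡ m)))
  Expected i j (suc (suc k)) = i + j < suc (suc k)

  N-swap : ∀ {a b} → Expected a b 0 → Expected b a 0
  N-swap = swap

  not-N-empty : ¬ Expected 0 0 0
  not-N-empty (inj₁ (() , _))
  not-N-empty (inj₂ (() , _))

  not-N-large : ∀ {a b} → m ≤ a → m ≤ b → ¬ Expected a b 0
  not-N-large m≤a m≤b (inj₁ (_ , b<m)) = <⇒≱ b<m m≤b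
  not-N-large m≤a m≤b (inj₂ (_ , a<m)) = <⇒≱ a<m m≤a

  N-small-heap : ∀ {a} b → 0 < a → a < m → Expected a b 0
  N-small-heap zero    0<a _   = inj₁ (0<a , 0<m)
  N-small-heap (suc b) _   a<m = inj₂ (z<s , a<m)

  Expected-N : ∀ i j → SomeMove (λ a b → a + b < m) i j ⇔ Expected i j 0
  Expected-N i j = mk⇔ reach move
    where
    reach : SomeMove (λ a b → a + b < m) i j → Expected i j 0
    reach (inj₁ (a , a<i , lt)) = inj₁ (≤-<-trans z≤n a<i , ≤-<-trans (m≤n+m j a) lt)
    reach (inj₂ (b , b<j , lt)) = inj₂ (≤-<-trans z≤n b<j , ≤-<-trans (m≤m+n i b) lt)

    move : Expected i j 0 → SomeMove (λ a b → a + b < m) i j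
    move (inj₁ (0<i , j<m)) = inj₁ (0 , 0<i , j<m)
    move (inj₂ (0<j , i<m)) = inj₂ (0 , 0<j , ≤-<-trans (≤-reflexive (+-identityʳ i)) i<m)

  Expected-O₁ : ∀ i j → EveryMove (λ a b → Expected a b 0) i j ⇔ Expected i j 1
  Expected-O₁ i j = mk⇔ (all-N i j) (from-O₁ i j)
    where
    all-N : ∀ i j → EveryMove (λ a b → Expected a b 0) i j → Expected i j 1
    all-N zero    zero    _        = inj₁ (refl , refl)
    all-N zero    (suc j) (_ , hR) = ⊥-elim (not-N-empty (hR 0 z<s))
    all-N (suc i) zero    (hL , _) = ⊥-elim (not-N-empty (hL 0 z<s))
    all-N (suc i) (suc j) (hL , hR) = inj₂ (z<s , z<s , small-or-both-m)
      where
      small-or-both-m : suc i < m ⊎ suc j < m ⊎ (suc i ≡ m × suc j ≡ m)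
      small-or-both-m with suc i <? m | suc j <? m
      ... | yes i<m | _       = inj₁ i<m
      ... | no  _   | yes j<m = inj₂ (inj₁ j<m)
      ... | no  i≮m | no  j≮m = inj₂ (inj₂ (≤-antisym i≤m m≤i , ≤-antisym j≤m m≤j))
        where
        m≤i = ≮⇒≥ i≮m
        m≤j = ≮⇒≥ j≮m
        i≤m = below-counterexample (not-N-large ≤-refl m≤j) hL
        j≤m = below-counterexample (not-N-large m≤i ≤-refl) hR

    from-O₁ : ∀ i j → Expected i j 1 → EveryMove (λ a b → Expected a b 0) i j
    from-O₁ .0 .0 (inj₁ (refl , refl)) = (λ _ ()) , (λ _ ())
    from-O₁ i j (inj₂ (0<i , 0<j , inj₁ i<m)) =
      (λ a a<i → inj₂ (0<j , <-trans a<i i<m)) , (λ b _ → N-small-heap b 0<i i<m)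
    from-O₁ i j (inj₂ (0<i , 0<j , inj₂ (inj₁ j<m))) =
      (λ a _ → N-swap (N-small-heap a 0<j j<m)) , (λ b b<j → inj₁ (0<i , <-trans b<j j<m))
    from-O₁ i j (inj₂ (0<i , 0<j , inj₂ (inj₂ (refl , refl)))) =
      (λ a a<m → inj₂ (0<m , a<m)) , (λ b b<m → inj₁ (0<m , b<m))

  -- Recursion for O_2: every move reaches an O_1-position; since *0 + *b with
  -- b > 0 is not one, only *0 + *0, *1 + *0 and *0 + *1 qualify.
  Expected-O₂ : ∀ i j → EveryMove (λ a b → Expected a b 1) i j ⇔ Expected i j 2
  Expected-O₂ i j = mk⇔ (all-O₁ i j) (from-O₂ i j)
    where
    all-O₁ : ∀ i j → EveryMove (λ a b → Expected a b 1) i j → Expected i j 2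
    all-O₁ zero          zero          _ = s≤s z≤n
    all-O₁ (suc zero)    zero          _ = s≤s (s≤s z≤n)
    all-O₁ zero          (suc zero)    _ = s≤s (s≤s z≤n)
    all-O₁ zero          (suc (suc j)) (_ , hR) with hR 1 (s≤s (s≤s z≤n))
    ... | inj₁ (_ , ())
    ... | inj₂ (() , _)
    all-O₁ (suc i)       (suc j)       (hL , _) with hL 0 z<s
    ... | inj₁ (_ , ())
    ... | inj₂ (() , _)
    all-O₁ (suc (suc i)) zero          (hL , _) with hL 1 (s≤s (s≤s z≤n))
    ... | inj₁ (() , _)
    ... | inj₂ (_ , () , _)

    from-O₂ : ∀ i j → Expected i j 2 → EveryMove (λ a b → Expected a b 1) i j
    from-O₂ zero          zero          _ = (λ _ ()) , (λ _ ())
    from-O₂ (suc zero)    zero          _ = (λ { zero _ → inj₁ (refl , refl) ; (suc _) (s≤s ()) }) , (λ _ ())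
    from-O₂ zero          (suc zero)    _ = (λ _ ()) , (λ { zero _ → inj₁ (refl , refl) ; (suc _) (s≤s ()) })
    from-O₂ zero          (suc (suc j)) (s≤s (s≤s ()))
    from-O₂ (suc zero)    (suc j)       (s≤s (s≤s ()))
    from-O₂ (suc (suc i)) j             (s≤s (s≤s ()))

  Expected-O : ∀ k i j → EveryMove (λ a b → Expected a b k) i j ⇔ Expected i j (suc k)
  Expected-O zero          = Expected-O₁
  Expected-O (suc zero)    = Expected-O₂
  Expected-O (suc (suc k)) = sum-after-every-move (suc (suc k))

  Matches : ℕ → ℕ → Set
  Matches i j = ∀ p → InOutcome (suc m) p (nim i ⊕ nim j) ⇔ Expected i j (toℕ p)

  matches-at : ∀ {i j k} (p : Fin (suc m)) → toℕ p ≡ k → Matches i j →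
    InOutcome (suc m) p (nim i ⊕ nim j) ⇔ Expected i j k
  matches-at p refl h = h p

  matches-step : ∀ i j → EveryMove Matches i j → Matches i j
  matches-step i j ih Fin.zero = begin
    SomeP m (options (nim i ⊕ nim j))
      ≈⟨ SomeP⇔Any m _ ⟩
    Any (InOutcome (suc m) (fromℕ m)) (options (nim i ⊕ nim j))
      ≈⟨ Any-options i j ⟩
    SomeMove (λ a b → InOutcome (suc m) (fromℕ m) (nim a ⊕ nim b)) i j
      ≈⟨ SomeMove-cong (EveryMove-map (matches-at (fromℕ m) (toℕ-fromℕ m)) ih) ⟩
    SomeMove (λ a b → a + b < m) i j
      ≈⟨ Expected-N i j ⟩
    Expected i j 0 ∎
  matches-step i j ih (Fin.suc q) = begin
    EveryO m q (options (nim i ⊕ nim j))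
      ≈⟨ EveryO⇔All m q _ ⟩
    All (InOutcome (suc m) (inject₁ q)) (options (nim i ⊕ nim j))
      ≈⟨ All-options i j ⟩
    EveryMove (λ a b → InOutcome (suc m) (inject₁ q) (nim a ⊕ nim b)) i j
      ≈⟨ EveryMove-cong (EveryMove-map (matches-at (inject₁ q) (toℕ-inject₁ q)) ih) ⟩
    EveryMove (λ a b → Expected a b (toℕ q)) i j
      ≈⟨ Expected-O (toℕ q) i j ⟩
    Expected i j (suc (toℕ q)) ∎

  matches : ∀ i j → Matches i j
  matches = <-rec _ λ i ihᵢ → <-rec _ λ j ihⱼ →
    matches-step i j ((λ a a<i → ihᵢ a<i j) , (λ b b<j → ihⱼ b<j))

  both-empty : ∀ k → Expected 0 0 k ⇔ (¬ (k ≡ 0))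
  both-empty zero          = mk⇔ (λ e → ⊥-elim (not-N-empty e)) (λ k≢0 → ⊥-elim (k≢0 refl))
  both-empty (suc zero)    = mk⇔ (λ _ ()) (λ _ → inj₁ (refl , refl))
  both-empty (suc (suc k)) = mk⇔ (λ _ ()) (λ _ → z<s)

  first-empty : ∀ j k → 0 < j → k ≤ m → Expected 0 j k ⇔ (¬ (1 ≤ k × k ≤ j ⊓ m))
  first-empty j zero          0<j _   = mk⇔ (λ { _ (() , _) }) (λ _ → inj₂ (0<j , 0<m))
  first-empty j (suc zero)    0<j _   = mk⇔ (λ e → ⊥-elim (not-O₁ e)) (λ ¬O₁ → ⊥-elim (¬O₁ (s≤s z≤n , ⊓-glb 0<j 0<m)))
    where
    not-O₁ : ¬ Expected 0 j 1
    not-O₁ (inj₁ (_ , refl)) = <-irrefl refl 0<j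
    not-O₁ (inj₂ (() , _))
  first-empty j (suc (suc k)) 0<j k≤m = <⇔¬≤⊓ (s≤s z≤n) k≤m

  first-small : ∀ i j k → 0 < i → i ≤ suc m' → i ≤ j → k ≤ m →
    Expected i j k ⇔ (¬ (2 ≤ k × k ≤ (i + j) ⊓ m))
  first-small i j zero          0<i i<m i≤j _   =
    mk⇔ (λ { _ (() , _) }) (λ _ → inj₂ (<-≤-trans 0<i i≤j , s≤s i<m))
  first-small i j (suc zero)    0<i i<m i≤j _   =
    mk⇔ (λ { _ (s≤s () , _) }) (λ _ → inj₂ (0<i , <-≤-trans 0<i i≤j , inj₁ (s≤s i<m)))
  first-small i j (suc (suc k)) 0<i i<m i≤j k≤m = <⇔¬≤⊓ (s≤s (s≤s z≤n)) k≤m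

  both-m : ∀ k → k ≤ m → Expected m m k ⇔ (k ≡ 1)
  both-m zero          _   = mk⇔ (λ e → ⊥-elim (not-N-large ≤-refl ≤-refl e)) (λ ())
  both-m (suc zero)    _   = mk⇔ (λ _ → refl) (λ _ → inj₂ (0<m , 0<m , inj₂ (inj₂ (refl , refl))))
  both-m (suc (suc k)) k≤m = mk⇔ (λ 2m<k → ⊥-elim (<⇒≱ (≤-<-trans (m≤m+n m m) 2m<k) k≤m)) (λ ())

  large : ∀ i j k → m ≤ i → i ≤ j → ¬ (i ≡ m × j ≡ m) → k ≤ m → ¬ Expected i j k
  large i j zero          m≤i i≤j _ _ e = not-N-large m≤i (≤-trans m≤i i≤j) e
  large i j (suc zero)    m≤i i≤j _ _ (inj₁ (refl , _)) = <⇒≱ 0<m m≤i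
  large i j (suc zero)    m≤i i≤j _ _ (inj₂ (_ , _ , inj₁ i<m)) = <⇒≱ i<m m≤i
  large i j (suc zero)    m≤i i≤j _ _ (inj₂ (_ , _ , inj₂ (inj₁ j<m))) = <⇒≱ j<m (≤-trans m≤i i≤j)
  large i j (suc zero)    m≤i i≤j ¬both _ (inj₂ (_ , _ , inj₂ (inj₂ both))) = ¬both both
  large i j (suc (suc k)) m≤i i≤j _ k≤m sum<k =
    <⇒≱ sum<k (≤-trans k≤m (≤-trans m≤i (m≤m+n i j)))

  claimed : ∀ i j k → i ≤ j → k ≤ m → Expected i j k ⇔ claimedOutcome (suc m) i j k
  claimed i j k i≤j k≤m =
    ⇔-if (≡ᵇ-reflects-≡ i 0 ×-reflects ≡ᵇ-reflects-≡ j 0)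
      (λ { (refl , refl) → both-empty k }) λ ¬both-empty →
    ⇔-if (≡ᵇ-reflects-≡ i 0)
      (λ { refl → first-empty j k (n≢0⇒n>0 (λ j≡0 → ¬both-empty (refl , j≡0))) k≤m }) λ i≢0 →
    ⇔-if (≤ᵇ-reflects-≤ i (suc m'))
      (λ i≤m-1 → first-small i j k (n≢0⇒n>0 i≢0) i≤m-1 i≤j k≤m) λ i≰m-1 →
    ⇔-if (≡ᵇ-reflects-≡ i m ×-reflects ≡ᵇ-reflects-≡ j m)
      (λ { (refl , refl) → both-m k k≤m }) λ ¬both-m →
    mk⇔ (large i j k (≰⇒> i≰m-1) i≤j ¬both-m k≤m) ⊥-elim

mainTheorem3 : (N i j : ℕ) → 2 < N → i ≤ j →
    (p : Fin N) → InOutcome N p (nim i ⊕ nim j) ⇔ claimedOutcome N i j (toℕ p)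
mainTheorem3 (suc (suc (suc m'))) i j (s≤s (s≤s (s≤s z≤n))) i≤j p =
  ⇔-trans (matches i j p) (claimed i j (toℕ p) i≤j (toℕ≤pred[n] p))
  where open Formula m'
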